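{- Let $n \geq 1$ be a fixed integer. Then $$B_n^{(m)} \sim \frac{n!}{2^{n-1}}\, m^{n-1} \quad (m \to \infty),$$ i.e. $\lim_{m\to\infty} B_n^{(m)} \big/ \left(\frac{n!}{2^{n-1}} m^{n-1}\right) = 1$.
   Context: For integers $m,n \geq 0$, the $m$-th order Bell numbers $B_n^{(m)}$ are defined by the exponential generating functions $E_m(x) = \sum_{n=0}^\infty B_n^{(m)} \frac{x^n}{n!}$, where $E_0(x) = \exp(x)$ and $E_{m+1}(x) = \exp(E_m(x) - 1)$ for $m \geq 0$. -}

module Defs where

open import Data.Nat as ℕ using (ℕ; zero; suc; _∸_; _≤_)
open import Data.Nat.Properties using (_!≢0; m*n≢0; m^n≢0)
open import Data.Nat using (_!)
open import Data.Integer using (+_)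
open import Data.Rational using (ℚ; 0ℚ; 1ℚ; _+_; _*_; _-_; _/_; ∣_∣; _<_)
open import Data.Product using (∃-syntax)

Series : Set
Series = ℕ → ℚ

sumTo : ℕ → (ℕ → ℚ) → ℚ
sumTo zero    f = f 0
sumTo (suc n) f = sumTo n f + f (suc n)

_⊛_ : Series → Series → Series
(f ⊛ g) n = sumTo n (λ i → f i * g (n ∸ i))

oneS : Series
oneS zero    = 1ℚ
oneS (suc _) = 0ℚ

powS : Series → ℕ → Series
powS f zero    = oneS
powS f (suc k) = f ⊛ powS f k

minusOne : Series → Series
minusOne f zero    = f 0 - 1ℚ
minusOne f (suc n) = f (suc n)

invFact : ℕ → ℚ
invFact k = (+ 1 / (k !)) {{k !≢0}}

-- exp(f) for a series f with zero constant term: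
-- coefficient n of Σ_k f^k / k!  (only k ≤ n contribute since f(0) = 0).
expS : Series → Series
expS f n = sumTo n (λ k → invFact k * powS f k n)

E : ℕ → Series
E zero    n = invFact n
E (suc m) = expS (minusOne (E m))

B : ℕ → ℕ → ℚ
B n m = (+ (n !) / 1) * E m n

-- The ratio  B_n^{(m)} / ( n! / 2^{n-1} · m^{n-1} ), for m ≥ 1.
-- (Defined as 0 at m = 0, where the denominator may vanish; irrelevant for the limit.)
ratio : ℕ → ℕ → ℚ
ratio n zero    = 0ℚ
ratio n (suc m) =
  B n (suc m) * (+ (2 ℕ.^ (n ∸ 1)) / (n ! ℕ.* (suc m ℕ.^ (n ∸ 1))))
    {{m*n≢0 (n !) (suc m ℕ.^ (n ∸ 1)) {{n !≢0}} {{m^n≢0 (suc m) (n ∸ 1)}}}}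

ConvergesTo : (ℕ → ℚ) → ℚ → Set
ConvergesTo s L = ∀ (ε : ℚ) → 0ℚ < ε → ∃[ M ] (∀ m → M ≤ m → ∣ s m - L ∣ < ε)

module Submission where

-- Write e_m(i) = [x^i] E_m = B_i^{(m)}/i! and F_m = E_m - 1.  As F_m has no
-- constant term, E_{m+1} = exp F_m gives for i ≥ 2 the recurrence
--   e_{m+1}(i) = e_m(i) + ½ [x^i] F_m² + Σ_{k≥3} [x^i] F_m^k / k!.
-- Put s_n(m) = 2^n e_m(n+1) and err_n(m) = s_n(m) - m^n.  The main claim is
-- err_n(m) = O(m^{n-1}) for every fixed n, by strong induction on n: below n it
-- makes every coefficient [x^i] F_m with i ≤ n an O(m^{i-1}), hence
-- [x^{n+1}] F_m^k = O(m^{n+1-k}); the quadratic term then reproduces the growth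
-- of (m+1)^n - m^n up to O(m^{n-2}), so the increments of err_n are O(m^{n-2})
-- and telescoping gives err_n = O(m^{n-1}).  The theorem follows from the exact
-- identity  ratio (n+1) (m+1) - 1 = err_n(m+1) / (m+1)^n.

open import Defs
open import Data.Nat as ℕ using (ℕ; zero; suc; _∸_; z≤n; s≤s)
import Data.Nat.Properties as ℕP
open import Data.Nat.Induction using (<-rec)
open import Data.Nat.Tactic.RingSolver using (solve-∀)
open import Data.Integer as ℤ using (+_)
import Data.Integer.Properties as ℤP
open import Data.Nat.Coprimality using (1-coprimeTo) renaming (sym to coprime-sym)
open import Data.Rational using (ℚ; mkℚ; 0ℚ; 1ℚ; _+_; _*_; _-_; -_; _/_; ∣_∣; _<_; _≤_; toℚᵘ; *≤*; *<*; NonNegative; Positive)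
open import Data.Rational.Properties
open import Data.Rational.Unnormalised as ℚᵘ using (mkℚᵘ) renaming (_≃_ to _≃ᵘ_)
import Data.Rational.Unnormalised.Properties as ℚᵘP
open import Data.Rational.Solver using (module +-*-Solver)
open +-*-Solver
open import Data.Product using (Σ; _,_; _×_; proj₁; proj₂)
open import Relation.Binary.PropositionalEquality
open import Relation.Nullary using (yes; no)

open ≤-Reasoning

opaque
  -- The embedding ℕ → ℚ.  It is opaque so that the normaliser never unfolds
  -- gcd computations on numerals; all we use are the lemmas below.
  ι : ℕ → ℚ
  ι k = mkℚ (+ k) 0 (coprime-sym (1-coprimeTo k))

  ι0 : ι 0 ≡ 0ℚ
  ι0 = refl

  ι1 : ι 1 ≡ 1ℚ
  ι1 = refl

  ι-+ : ∀ a b → ι (a ℕ.+ b) ≡ ι a + ι b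
  ι-+ a b = sym (trans
    (cong₂ (λ x y → (x ℤ.+ y) / 1) (ℤP.*-identityʳ (+ a)) (ℤP.*-identityʳ (+ b)))
    (↥p/↧p≡p (ι (a ℕ.+ b))))

  ι-* : ∀ a b → ι (a ℕ.* b) ≡ ι a * ι b
  ι-* a b = sym (trans (cong (λ x → x / 1) (ℤP.+◃n≡+n (a ℕ.* b))) (↥p/↧p≡p (ι (a ℕ.* b))))

  ι-mono : ∀ {a b} → a ℕ.≤ b → ι a ≤ ι b
  ι-mono {a} {b} a≤b =
    *≤* (subst₂ ℤ._≤_ (sym (ℤP.*-identityʳ (+ a))) (sym (ℤP.*-identityʳ (+ b))) (ℤ.+≤+ a≤b))

  ι-< : ∀ {a b} → a ℕ.< b → ι a < ι b
  ι-< {a} {b} a<b =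
    *<* (subst₂ ℤ._<_ (sym (ℤP.*-identityʳ (+ a))) (sym (ℤP.*-identityʳ (+ b))) (ℤ.+<+ a<b))

  ∣ι∣ : ∀ a → ∣ ι a ∣ ≡ ι a
  ∣ι∣ a = refl

  instance
    ι-nonNeg : ∀ {a} → NonNegative (ι a)
    ι-nonNeg = _

  ι-pos : ∀ k .{{_ : ℕ.NonZero k}} → Positive (ι k)
  ι-pos (suc k) = _

  half-of-two : invFact 2 * ι 2 ≡ 1ℚ
  half-of-two = refl

  clear-denominator : ∀ x a b → toℚᵘ x ≃ᵘ mkℚᵘ (+ a) b → x * ι (suc b) ≡ ι a
  clear-denominator x a b x≃a/b = toℚᵘ-injective (ℚᵘP.≃-trans (toℚᵘ-homo-* x (ι (suc b)))
    (ℚᵘP.≃-trans (ℚᵘP.*-congʳ {mkℚᵘ (+ suc b) 0} x≃a/b) (ℚᵘ.*≡* cross)))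
    where
    cross : (+ a ℤ.* + suc b) ℤ.* + 1 ≡ + a ℤ.* + suc (b ℕ.* 1)
    cross rewrite ℕP.*-identityʳ b = ℤP.*-identityʳ _

  ι-dominates : ∀ q → Σ ℕ λ K → ∣ q ∣ ≤ ι K
  ι-dominates (mkℚ n d _) = ℤ.∣ n ∣ , *≤* (subst₂ ℤ._≤_ (sym (ℤP.+◃n≡+n _)) (sym (ℤP.+◃n≡+n _))
    (ℤ.+≤+ (ℕP.*-monoʳ-≤ ℤ.∣ n ∣ (s≤s z≤n))))

ι-suc : ∀ a → ι (suc a) ≡ 1ℚ + ι a
ι-suc a = trans (ι-+ 1 a) (cong (_+ ι a) ι1)

∣*ι∣ : ∀ x k → ∣ x * ι k ∣ ≡ ∣ x ∣ * ι k
∣*ι∣ x k = trans (∣p*q∣≡∣p∣*∣q∣ x (ι k)) (cong (∣ x ∣ *_) (∣ι∣ k))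

fraction-cancel : ∀ a D .{{_ : ℕ.NonZero D}} → (+ a / D) * ι D ≡ ι a
fraction-cancel a (suc D) = clear-denominator _ a D (toℚᵘ-fromℚᵘ (mkℚᵘ (+ a) D))

fraction-whole : ∀ a → + a / 1 ≡ ι a
fraction-whole a = trans (sym (*-identityʳ _)) (trans (cong ((+ a / 1) *_) (sym ι1)) (fraction-cancel a 1))

positive-as-fraction : ∀ ε → 0ℚ < ε → Σ ℕ λ a → Σ ℕ λ b → ε * ι (suc b) ≡ ι (suc a) × NonNegative ε
positive-as-fraction (mkℚ (+ suc a) b _) _ = a , b , clear-denominator _ (suc a) b ℚᵘP.≃-refl , _
positive-as-fraction (mkℚ (+ 0) b _) (*<* (ℤ.+<+ ()))
positive-as-fraction (mkℚ ℤ.-[1+ a ] b _) (*<* ())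

^-distribʳ-* : ∀ a b d → (a ℕ.* b) ℕ.^ d ≡ a ℕ.^ d ℕ.* b ℕ.^ d
^-distribʳ-* a b zero    = refl
^-distribʳ-* a b (suc d) = trans (cong (a ℕ.* b ℕ.*_) (^-distribʳ-* a b d)) (interchange a b _ _)
  where
  interchange : ∀ a b u v → a ℕ.* b ℕ.* (u ℕ.* v) ≡ a ℕ.* u ℕ.* (b ℕ.* v)
  interchange = solve-∀

-- x = O((m+1)^d): one constant bounds |x m| by const·(m+1)^d for every m.
-- Using m+1 instead of m lets the bound hold uniformly, including at m = 0.
record BigO (d : ℕ) (x : ℕ → ℚ) : Set where
  constructor bigO
  field
    const : ℕ
    bound : ∀ m → ∣ x m ∣ ≤ ι (const ℕ.* suc m ℕ.^ d)

BigO-cong : ∀ {d x y} → (∀ m → x m ≡ y m) → BigO d x → BigO d y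
BigO-cong x≡y (bigO K h) = bigO K λ m → subst (λ z → ∣ z ∣ ≤ _) (x≡y m) (h m)

BigO-≡ : ∀ {d d' x} → d ≡ d' → BigO d x → BigO d' x
BigO-≡ refl b = b

BigO-weaken : ∀ {d d' x} → d ℕ.≤ d' → BigO d x → BigO d' x
BigO-weaken d≤d' (bigO K h) =
  bigO K λ m → ≤-trans (h m) (ι-mono (ℕP.*-monoʳ-≤ K (ℕP.^-monoʳ-≤ (suc m) d≤d')))

BigO-zero : ∀ {d x} → (∀ m → x m ≡ 0ℚ) → BigO d x
BigO-zero x≡0 = bigO 0 λ m → subst (λ z → ∣ z ∣ ≤ ι 0) (sym (x≡0 m)) (≤-reflexive (sym ι0))

BigO-const : ∀ c → BigO 0 (λ _ → c)
BigO-const c with ι-dominates c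
... | K , ∣c∣≤K = bigO K λ m → subst (λ z → ∣ c ∣ ≤ ι z) (sym (ℕP.*-identityʳ K)) ∣c∣≤K

BigO-pow : ∀ d → BigO d (λ m → ι (m ℕ.^ d))
BigO-pow d = bigO 1 λ m → begin
  ∣ ι (m ℕ.^ d) ∣         ≡⟨ ∣ι∣ _ ⟩
  ι (m ℕ.^ d)             ≤⟨ ι-mono (ℕP.^-monoˡ-≤ d (ℕP.n≤1+n m)) ⟩
  ι (suc m ℕ.^ d)         ≡⟨ cong ι (sym (ℕP.*-identityˡ _)) ⟩
  ι (1 ℕ.* suc m ℕ.^ d)   ∎

BigO-+ : ∀ {d x y} → BigO d x → BigO d y → BigO d (λ m → x m + y m)
BigO-+ {d} {x} {y} (bigO K₁ h₁) (bigO K₂ h₂) = bigO (K₁ ℕ.+ K₂) λ m → begin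
  ∣ x m + y m ∣                                    ≤⟨ ∣p+q∣≤∣p∣+∣q∣ (x m) (y m) ⟩
  ∣ x m ∣ + ∣ y m ∣                                ≤⟨ +-mono-≤ (h₁ m) (h₂ m) ⟩
  ι (K₁ ℕ.* suc m ℕ.^ d) + ι (K₂ ℕ.* suc m ℕ.^ d)  ≡⟨ sym (ι-+ _ _) ⟩
  ι (K₁ ℕ.* suc m ℕ.^ d ℕ.+ K₂ ℕ.* suc m ℕ.^ d)    ≡⟨ cong ι (sym (ℕP.*-distribʳ-+ (suc m ℕ.^ d) K₁ K₂)) ⟩
  ι ((K₁ ℕ.+ K₂) ℕ.* suc m ℕ.^ d)                  ∎

BigO-neg : ∀ {d x} → BigO d x → BigO d (λ m → - x m)
BigO-neg {x = x} (bigO K h) = bigO K λ m → subst (_≤ _) (sym (∣-p∣≡∣p∣ (x m))) (h m)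

BigO-- : ∀ {d x y} → BigO d x → BigO d y → BigO d (λ m → x m - y m)
BigO-- bx by = BigO-+ bx (BigO-neg by)

BigO-* : ∀ {a b x y} → BigO a x → BigO b y → BigO (a ℕ.+ b) (λ m → x m * y m)
BigO-* {a} {b} {x} {y} (bigO K₁ h₁) (bigO K₂ h₂) = bigO (K₁ ℕ.* K₂) λ m → begin
  ∣ x m * y m ∣                                       ≡⟨ ∣p*q∣≡∣p∣*∣q∣ (x m) (y m) ⟩
  ∣ x m ∣ * ∣ y m ∣                                   ≤⟨ *-monoˡ-≤-nonNeg ∣ x m ∣ {{∣-∣-nonNeg (x m)}} (h₂ m) ⟩
  ∣ x m ∣ * ι (K₂ ℕ.* suc m ℕ.^ b)                    ≤⟨ *-monoʳ-≤-nonNeg (ι (K₂ ℕ.* suc m ℕ.^ b)) (h₁ m) ⟩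
  ι (K₁ ℕ.* suc m ℕ.^ a) * ι (K₂ ℕ.* suc m ℕ.^ b)     ≡⟨ sym (ι-* _ _) ⟩
  ι (K₁ ℕ.* suc m ℕ.^ a ℕ.* (K₂ ℕ.* suc m ℕ.^ b))     ≡⟨ cong ι (collect K₁ K₂ (suc m ℕ.^ a) (suc m ℕ.^ b)) ⟩
  ι (K₁ ℕ.* K₂ ℕ.* (suc m ℕ.^ a ℕ.* suc m ℕ.^ b))     ≡⟨ cong (λ z → ι (K₁ ℕ.* K₂ ℕ.* z)) (sym (ℕP.^-distribˡ-+-* (suc m) a b)) ⟩
  ι (K₁ ℕ.* K₂ ℕ.* suc m ℕ.^ (a ℕ.+ b))               ∎
  where
  collect : ∀ k l u v → k ℕ.* u ℕ.* (l ℕ.* v) ≡ k ℕ.* l ℕ.* (u ℕ.* v)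
  collect = solve-∀

BigO-·suc : ∀ {d x} → BigO d x → BigO (suc d) (λ m → x m * ι (suc m))
BigO-·suc {d} {x} (bigO K h) = bigO K λ m → begin
  ∣ x m * ι (suc m) ∣                 ≡⟨ ∣*ι∣ (x m) (suc m) ⟩
  ∣ x m ∣ * ι (suc m)                 ≤⟨ *-monoʳ-≤-nonNeg (ι (suc m)) (h m) ⟩
  ι (K ℕ.* suc m ℕ.^ d) * ι (suc m)   ≡⟨ sym (ι-* _ _) ⟩
  ι (K ℕ.* suc m ℕ.^ d ℕ.* suc m)     ≡⟨ cong ι (extra-factor K (suc m ℕ.^ d) (suc m)) ⟩
  ι (K ℕ.* suc m ℕ.^ suc d)           ∎
  where
  extra-factor : ∀ k u s → k ℕ.* u ℕ.* s ≡ k ℕ.* (s ℕ.* u)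
  extra-factor = solve-∀

BigO-/suc : ∀ {d x} → BigO (suc d) (λ m → x m * ι (suc m)) → BigO d x
BigO-/suc {d} {x} (bigO K h) = bigO K λ m → *-cancelʳ-≤-pos (ι (suc m)) {{ι-pos (suc m)}} (begin
  ∣ x m ∣ * ι (suc m)                 ≡⟨ sym (∣*ι∣ (x m) (suc m)) ⟩
  ∣ x m * ι (suc m) ∣                 ≤⟨ h m ⟩
  ι (K ℕ.* suc m ℕ.^ suc d)           ≡⟨ cong ι (extra-factor K (suc m ℕ.^ d) (suc m)) ⟩
  ι (K ℕ.* suc m ℕ.^ d ℕ.* suc m)     ≡⟨ ι-* _ _ ⟩
  ι (K ℕ.* suc m ℕ.^ d) * ι (suc m)   ∎)
  where
  extra-factor : ∀ k u s → k ℕ.* (s ℕ.* u) ≡ k ℕ.* u ℕ.* s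
  extra-factor = solve-∀

BigO-cancel : ∀ {d x} (c : ℕ → ℕ) → (∀ m → 1 ℕ.≤ c m) → BigO d (λ m → x m * ι (c m)) → BigO d x
BigO-cancel {d} {x} c 1≤c (bigO K h) = bigO K λ m → begin
  ∣ x m ∣                  ≡⟨ sym (*-identityʳ _) ⟩
  ∣ x m ∣ * 1ℚ             ≤⟨ *-monoˡ-≤-nonNeg ∣ x m ∣ {{∣-∣-nonNeg (x m)}} (subst (_≤ ι (c m)) ι1 (ι-mono (1≤c m))) ⟩
  ∣ x m ∣ * ι (c m)        ≡⟨ sym (∣*ι∣ (x m) (c m)) ⟩
  ∣ x m * ι (c m) ∣        ≤⟨ h m ⟩
  ι (K ℕ.* suc m ℕ.^ d)    ∎

-- Shifting the argument costs the factor 2^d, as m+2 ≤ 2(m+1).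
BigO-shift : ∀ {d x} → BigO d x → BigO d (λ m → x (suc m))
BigO-shift {d} (bigO K h) = bigO (K ℕ.* 2 ℕ.^ d) λ m → ≤-trans (h (suc m)) (ι-mono (ℕP.≤-trans
  (ℕP.*-monoʳ-≤ K (ℕP.^-monoˡ-≤ d (m+2≤2[m+1] m)))
  (ℕP.≤-reflexive (trans (cong (K ℕ.*_) (^-distribʳ-* 2 (suc m) d)) (sym (ℕP.*-assoc K _ _))))))
  where
  double : ∀ m → 2 ℕ.+ m ℕ.+ m ≡ 2 ℕ.* suc m
  double = solve-∀
  m+2≤2[m+1] : ∀ m → suc (suc m) ℕ.≤ 2 ℕ.* suc m
  m+2≤2[m+1] m = ℕP.≤-trans (ℕP.m≤m+n (2 ℕ.+ m) m) (ℕP.≤-reflexive (double m))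

BigO-sum : ∀ {d} N (g : ℕ → ℕ → ℚ) → (∀ i → i ℕ.≤ N → BigO d (g i)) → BigO d (λ m → sumTo N (λ i → g i m))
BigO-sum zero    g h = h 0 z≤n
BigO-sum (suc N) g h = BigO-+ (BigO-sum N g (λ i i≤N → h i (ℕP.m≤n⇒m≤1+n i≤N))) (h (suc N) ℕP.≤-refl)

-- Telescoping: if the increments of e are O((m+1)^d) then e is O((m+1)^{d+1}).
-- Inductively |e m| ≤ K₀ + K·m·(m+1)^d, with K₀ bounding |e 0|.
BigO-telescope : ∀ {d} (e r : ℕ → ℚ) → (∀ m → e (suc m) ≡ e m + r m) → BigO d r → BigO (suc d) e
BigO-telescope {d} e r step (bigO K h) with ι-dominates (e 0)
... | K₀ , ∣e0∣≤K₀ = bigO (K₀ ℕ.+ K) λ m → ≤-trans (partial m) (ι-mono (final K₀ K m d))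
  where
  partial : ∀ m → ∣ e m ∣ ≤ ι (K₀ ℕ.+ K ℕ.* m ℕ.* suc m ℕ.^ d)
  partial zero = subst (λ z → ∣ e 0 ∣ ≤ ι z) (sym (no-steps K₀ K (1 ℕ.^ d))) ∣e0∣≤K₀
    where
    no-steps : ∀ a k u → a ℕ.+ k ℕ.* 0 ℕ.* u ≡ a
    no-steps = solve-∀
  partial (suc m) = begin
    ∣ e (suc m) ∣                                                ≡⟨ cong ∣_∣ (step m) ⟩
    ∣ e m + r m ∣                                                ≤⟨ ∣p+q∣≤∣p∣+∣q∣ (e m) (r m) ⟩
    ∣ e m ∣ + ∣ r m ∣                                            ≤⟨ +-mono-≤ (partial m) (h m) ⟩
    ι (K₀ ℕ.+ K ℕ.* m ℕ.* suc m ℕ.^ d) + ι (K ℕ.* suc m ℕ.^ d)  ≡⟨ sym (ι-+ _ _) ⟩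
    ι (K₀ ℕ.+ K ℕ.* m ℕ.* suc m ℕ.^ d ℕ.+ K ℕ.* suc m ℕ.^ d)    ≤⟨ ι-mono (increment K₀ K m (ℕP.^-monoˡ-≤ d (ℕP.n≤1+n (suc m)))) ⟩
    ι (K₀ ℕ.+ K ℕ.* suc m ℕ.* suc (suc m) ℕ.^ d)                ∎
    where
    regroup : ∀ a k m u → a ℕ.+ k ℕ.* m ℕ.* u ℕ.+ k ℕ.* u ≡ a ℕ.+ k ℕ.* suc m ℕ.* u
    regroup = solve-∀
    increment : ∀ a k m {u u'} → u ℕ.≤ u' → a ℕ.+ k ℕ.* m ℕ.* u ℕ.+ k ℕ.* u ℕ.≤ a ℕ.+ k ℕ.* suc m ℕ.* u'
    increment a k m {u} u≤u' =
      ℕP.≤-trans (ℕP.≤-reflexive (regroup a k m u)) (ℕP.+-monoʳ-≤ a (ℕP.*-monoʳ-≤ (k ℕ.* suc m) u≤u'))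
  final : ∀ a k m d → a ℕ.+ k ℕ.* m ℕ.* suc m ℕ.^ d ℕ.≤ (a ℕ.+ k) ℕ.* suc m ℕ.^ suc d
  final a k m d = ℕP.≤-trans (ℕP.+-mono-≤ a≤ km≤) (ℕP.≤-reflexive (sym (ℕP.*-distribʳ-+ (suc m ℕ.^ suc d) a k)))
    where
    a≤ : a ℕ.≤ a ℕ.* suc m ℕ.^ suc d
    a≤ = ℕP.m≤m*n a (suc m ℕ.^ suc d) {{ℕP.m^n≢0 (suc m) (suc d)}}
    km≤ : k ℕ.* m ℕ.* suc m ℕ.^ d ℕ.≤ k ℕ.* suc m ℕ.^ suc d
    km≤ = ℕP.≤-trans (ℕP.≤-reflexive (ℕP.*-assoc k m _)) (ℕP.*-monoʳ-≤ k (ℕP.*-monoˡ-≤ (suc m ℕ.^ d) (ℕP.n≤1+n m)))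

sumTo-cong : ∀ N {f g : ℕ → ℚ} → (∀ i → i ℕ.≤ N → f i ≡ g i) → sumTo N f ≡ sumTo N g
sumTo-cong zero    f≡g = f≡g 0 z≤n
sumTo-cong (suc N) f≡g = cong₂ _+_ (sumTo-cong N (λ i i≤N → f≡g i (ℕP.m≤n⇒m≤1+n i≤N))) (f≡g (suc N) ℕP.≤-refl)

sumTo-zero : ∀ N {f : ℕ → ℚ} → (∀ i → i ℕ.≤ N → f i ≡ 0ℚ) → sumTo N f ≡ 0ℚ
sumTo-zero N f≡0 = trans (sumTo-cong N f≡0) (zeros N)
  where
  zeros : ∀ N → sumTo N (λ _ → 0ℚ) ≡ 0ℚ
  zeros zero    = refl
  zeros (suc N) = cong (_+ 0ℚ) (zeros N)

sumTo-split : ∀ N (f : ℕ → ℚ) → sumTo (suc N) f ≡ f 0 + sumTo N (λ i → f (suc i))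
sumTo-split zero    f = refl
sumTo-split (suc N) f = trans (cong (_+ f (suc (suc N))) (sumTo-split N f)) (+-assoc (f 0) _ _)

sumTo-const : ∀ N c → sumTo N (λ _ → c) ≡ ι (suc N) * c
sumTo-const zero    c = sym (trans (cong (_* c) ι1) (*-identityˡ c))
sumTo-const (suc N) c = begin-equality
  sumTo N (λ _ → c) + c   ≡⟨ cong (_+ c) (sumTo-const N c) ⟩
  ι (suc N) * c + c       ≡⟨ solve 2 (λ a c → a :* c :+ c := (con 1ℚ :+ a) :* c) refl (ι (suc N)) c ⟩
  (1ℚ + ι (suc N)) * c    ≡⟨ cong (_* c) (sym (ι-suc (suc N))) ⟩
  ι (suc (suc N)) * c     ∎

sumTo-sub : ∀ N (a b : ℕ → ℚ) → sumTo N (λ i → a i - b i) ≡ sumTo N a - sumTo N b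
sumTo-sub zero    a b = refl
sumTo-sub (suc N) a b = trans (cong (_+ (a (suc N) - b (suc N))) (sumTo-sub N a b))
  (solve 4 (λ x y u v → (x :- y) :+ (u :- v) := (x :+ u) :- (y :+ v)) refl
    (sumTo N a) (sumTo N b) (a (suc N)) (b (suc N)))

sumTo-*ˡ : ∀ N c (a : ℕ → ℚ) → sumTo N (λ i → c * a i) ≡ c * sumTo N a
sumTo-*ˡ zero    c a = refl
sumTo-*ˡ (suc N) c a = trans (cong (_+ (c * a (suc N))) (sumTo-*ˡ N c a)) (sym (*-distribˡ-+ c _ _))

sumTo-*ʳ : ∀ N c (a : ℕ → ℚ) → sumTo N (λ i → a i * c) ≡ sumTo N a * c
sumTo-*ʳ zero    c a = refl
sumTo-*ʳ (suc N) c a = trans (cong (_+ (a (suc N) * c)) (sumTo-*ʳ N c a)) (sym (*-distribʳ-+ c (sumTo N a) (a (suc N))))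

⊛-identityʳ : ∀ (f : Series) n → (f ⊛ oneS) n ≡ f n
⊛-identityʳ f zero    = *-identityʳ (f 0)
⊛-identityʳ f (suc N) = begin-equality
  sumTo N (λ i → f i * oneS (suc N ∸ i)) + f (suc N) * oneS (N ∸ N)
    ≡⟨ cong₂ _+_ (sumTo-zero N off-diagonal) (cong (λ k → f (suc N) * oneS k) (ℕP.n∸n≡0 N)) ⟩
  0ℚ + f (suc N) * 1ℚ  ≡⟨ trans (+-identityˡ _) (*-identityʳ (f (suc N))) ⟩
  f (suc N)            ∎
  where
  off-diagonal : ∀ i → i ℕ.≤ N → f i * oneS (suc N ∸ i) ≡ 0ℚ
  off-diagonal i i≤N rewrite ℕP.+-∸-assoc 1 i≤N = *-zeroʳ (f i)

powS-vanish : ∀ (f : Series) → f 0 ≡ 0ℚ → ∀ k j → j ℕ.< k → powS f k j ≡ 0ℚ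
powS-vanish f f0≡0 (suc k) j j<1+k = sumTo-zero j term
  where
  term : ∀ i → i ℕ.≤ j → f i * powS f k (j ∸ i) ≡ 0ℚ
  term zero    _ = trans (cong (_* powS f k j) f0≡0) (*-zeroˡ (powS f k j))
  term (suc i) i<j = trans (cong (f (suc i) *_) (powS-vanish f f0≡0 k (j ∸ suc i) j-i-1<k)) (*-zeroʳ (f (suc i)))
    where
    j-i-1<k : j ∸ suc i ℕ.< k
    j-i-1<k = ℕP.<-≤-trans (ℕP.∸-monoʳ-< {j} {suc i} {0} (s≤s z≤n) i<j) (ℕP.≤-pred j<1+k)

powS-two : ∀ (f : Series) n → powS f 2 n ≡ (f ⊛ f) n
powS-two f n = sumTo-cong n (λ i _ → cong (f i *_) (⊛-identityʳ f (n ∸ i)))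

⊛-inner : ∀ (f g : Series) → f 0 ≡ 0ℚ → g 0 ≡ 0ℚ → ∀ q →
          (f ⊛ g) (suc (suc q)) ≡ sumTo q (λ j → f (suc j) * g (suc (q ∸ j)))
⊛-inner f g f0≡0 g0≡0 q = begin-equality
  sumTo (suc (suc q)) (λ i → f i * g (suc (suc q) ∸ i))
    ≡⟨ sumTo-split (suc q) _ ⟩
  f 0 * g (suc (suc q)) + (S + f (suc (suc q)) * g (q ∸ q))
    ≡⟨ cong₂ (λ a b → a * g (suc (suc q)) + (S + f (suc (suc q)) * b)) f0≡0 (trans (cong g (ℕP.n∸n≡0 q)) g0≡0) ⟩
  0ℚ * g (suc (suc q)) + (S + f (suc (suc q)) * 0ℚ)
    ≡⟨ solve 3 (λ a b s → con 0ℚ :* a :+ (s :+ b :* con 0ℚ) := s) refl (g (suc (suc q))) (f (suc (suc q))) S ⟩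
  S
    ≡⟨ sumTo-cong q (λ j j≤q → cong (λ k → f (suc j) * g k) (ℕP.+-∸-assoc 1 j≤q)) ⟩
  sumTo q (λ j → f (suc j) * g (suc (q ∸ j))) ∎
  where
  S = sumTo q (λ j → f (suc j) * g (suc q ∸ j))

expS-split : ∀ (f : Series) q → expS f (suc (suc q)) ≡
             f (suc (suc q)) + sumTo q (λ k → invFact (2 ℕ.+ k) * powS f (2 ℕ.+ k) (suc (suc q)))
expS-split f q = begin-equality
  expS f I                                       ≡⟨ sumTo-split (suc q) t ⟩
  t 0 + sumTo (suc q) (λ k → t (suc k))          ≡⟨ cong (λ z → t 0 + z) (sumTo-split q (λ k → t (suc k))) ⟩
  0ℚ + (invFact 1 * (f ⊛ oneS) I + S)            ≡⟨ cong (λ z → 0ℚ + (invFact 1 * z + S)) (⊛-identityʳ f I) ⟩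
  0ℚ + (1ℚ * f I + S)                            ≡⟨ solve 2 (λ a s → con 0ℚ :+ (con 1ℚ :* a :+ s) := a :+ s) refl (f I) S ⟩
  f I + S                                        ∎
  where
  I = suc (suc q)
  t : ℕ → ℚ
  t k = invFact k * powS f k I
  S = sumTo q (λ k → t (suc (suc k)))

F : ℕ → Series
F m = minusOne (E m)

E-0 : ∀ m → E m 0 ≡ 1ℚ
E-0 zero    = refl
E-0 (suc m) = refl

F-0 : ∀ m → F m 0 ≡ 0ℚ
F-0 m = cong (_- 1ℚ) (E-0 m)

E-1 : ∀ m → E m 1 ≡ 1ℚ
E-1 zero    = refl
E-1 (suc m) = cong (λ z → invFact 0 * oneS 1 + invFact 1 * z) (trans (⊛-identityʳ (F m) 1) (E-1 m))

Q : ℕ → ℕ → ℚ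
Q m I = (F m ⊛ F m) I

higher : ℕ → ℕ → ℚ
higher m p = sumTo p (λ k → invFact (3 ℕ.+ k) * powS (F m) (3 ℕ.+ k) (3 ℕ.+ p))

E-step-2 : ∀ m → E (suc m) 2 ≡ E m 2 + invFact 2 * Q m 2
E-step-2 m = trans (expS-split (F m) 0) (cong (λ z → E m 2 + invFact 2 * z) (powS-two (F m) 2))

E-step : ∀ m p → E (suc m) (3 ℕ.+ p) ≡ E m (3 ℕ.+ p) + (invFact 2 * Q m (3 ℕ.+ p) + higher m p)
E-step m p = begin-equality
  E (suc m) I                                     ≡⟨ expS-split (F m) (suc p) ⟩
  E m I + sumTo (suc p) t                         ≡⟨ cong (λ z → E m I + z) (sumTo-split p t) ⟩
  E m I + (invFact 2 * powS (F m) 2 I + higher m p) ≡⟨ cong (λ z → E m I + (invFact 2 * z + higher m p)) (powS-two (F m) I) ⟩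
  E m I + (invFact 2 * Q m I + higher m p)        ∎
  where
  I = 3 ℕ.+ p
  t : ℕ → ℚ
  t k = invFact (2 ℕ.+ k) * powS (F m) (2 ℕ.+ k) I

Q-2 : ∀ m → Q m 2 ≡ 1ℚ
Q-2 m = trans (cong₂ (λ a b → (a * F m 2 + b * b) + F m 2 * a) (F-0 m) (E-1 m))
  (solve 1 (λ x → (con 0ℚ :* x :+ con 1ℚ :* con 1ℚ) :+ x :* con 0ℚ := con 1ℚ) refl (F m 2))

E-2 : ∀ m → E m 2 ≡ ι (suc m) * invFact 2
E-2 zero    = sym (trans (cong (_* invFact 2) ι1) (*-identityˡ _))
E-2 (suc m) = begin-equality
  E (suc m) 2                                 ≡⟨ E-step-2 m ⟩
  E m 2 + invFact 2 * Q m 2                   ≡⟨ cong₂ (λ a b → a + invFact 2 * b) (E-2 m) (Q-2 m) ⟩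
  ι (suc m) * invFact 2 + invFact 2 * 1ℚ      ≡⟨ solve 2 (λ a h → a :* h :+ h :* con 1ℚ := (con 1ℚ :+ a) :* h) refl (ι (suc m)) (invFact 2) ⟩
  (1ℚ + ι (suc m)) * invFact 2                ≡⟨ cong (_* invFact 2) (sym (ι-suc (suc m))) ⟩
  ι (suc (suc m)) * invFact 2                 ∎

scaled : ℕ → ℕ → ℚ
scaled n m = E m (suc n) * ι (2 ℕ.^ n)

err : ℕ → ℕ → ℚ
err n m = scaled n m - ι (m ℕ.^ n)

-- The main claim err_n = O(m^{n-1}), with the extra factor m+1 so that n = 0
-- needs no special treatment.
ErrorBound : ℕ → Set
ErrorBound n = BigO n (λ m → err n m * ι (suc m))

scaled-bound : ∀ n → ErrorBound n → BigO n (scaled n)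
scaled-bound n eb = BigO-cong (λ m → solve 2 (λ s u → (s :- u) :+ u := s) refl (scaled n m) (ι (m ℕ.^ n)))
  (BigO-+ (BigO-cancel {x = err n} suc (λ _ → s≤s z≤n) eb) (BigO-pow n))

E-bound : ∀ n → ErrorBound n → BigO n (λ m → E m (suc n))
E-bound n eb = BigO-cancel (λ _ → 2 ℕ.^ n) (λ _ → ℕP.m^n>0 2 n) (scaled-bound n eb)

error-bound-0 : ErrorBound 0
error-bound-0 = BigO-zero λ m → trans (cong₂ (λ a b → (a * b - b) * ι (suc m)) (E-1 m) ι1) (*-zeroˡ (ι (suc m)))

error-bound-1 : ErrorBound 1
error-bound-1 = BigO-cong (λ m → cong (_* ι (suc m)) (sym (err-1 m))) (BigO-·suc (BigO-const 1ℚ))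
  where
  err-1 : ∀ m → err 1 m ≡ 1ℚ
  err-1 m = begin-equality
    E m 2 * ι 2 - ι (m ℕ.* 1)              ≡⟨ cong₂ (λ a b → a * ι 2 - ι b) (E-2 m) (ℕP.*-identityʳ m) ⟩
    ι (suc m) * invFact 2 * ι 2 - ι m      ≡⟨ cong (_- ι m) (*-assoc (ι (suc m)) (invFact 2) (ι 2)) ⟩
    ι (suc m) * (invFact 2 * ι 2) - ι m    ≡⟨ cong₂ (λ a b → a * b - ι m) (ι-suc m) half-of-two ⟩
    (1ℚ + ι m) * 1ℚ - ι m                  ≡⟨ solve 1 (λ x → (con 1ℚ :+ x) :* con 1ℚ :- x := con 1ℚ) refl (ι m) ⟩
    1ℚ                                     ∎

-- Index arithmetic for the term  f_{i+1} · [x^{j-i-1}] f^{k+1}  of [x^j] f^{k+2}.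
degree-sum : ∀ i j k → suc i ℕ.≤ j → suc k ℕ.≤ j ∸ suc i → i ℕ.+ ((j ∸ suc i) ∸ suc k) ≡ j ∸ suc (suc k)
degree-sum i j k i<j long = trans (sym (ℕP.+-∸-assoc i long)) (cong (_∸ suc (suc k)) (ℕP.m+[n∸m]≡n i<j))

factor-index : ∀ {i j k N} → suc i ℕ.≤ j → suc k ℕ.≤ j ∸ suc i → j ℕ.≤ suc k ℕ.+ N → suc i ℕ.≤ N
factor-index {i} {j} {k} {N} i<j long j≤ = ℕP.+-cancelˡ-≤ (suc k) (suc i) N
  (ℕP.≤-trans (ℕP.≤-trans (ℕP.+-monoˡ-≤ (suc i) long) (ℕP.≤-reflexive (ℕP.m∸n+n≡m i<j))) j≤)

cofactor-index : ∀ {i j k N} → j ℕ.≤ suc k ℕ.+ N → j ∸ suc i ℕ.≤ k ℕ.+ N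
cofactor-index {i} {j} {k} {N} j≤ = ℕP.m≤n+o⇒m∸n≤o j (suc i) (ℕP.≤-trans j≤ (s≤s (ℕP.m≤n+m (k ℕ.+ N) i)))

CoefficientBounds : (ℕ → Series) → ℕ → Set
CoefficientBounds f N = ∀ i → 1 ℕ.≤ i → i ℕ.≤ N → BigO (i ∸ 1) (λ m → f m i)

-- Then [x^j] f_m^{k+1} = O(m^{j-k-1}) as long as it only involves those coefficients
-- (j ≤ k + N); by induction on k, expanding f^{k+2} = f · f^{k+1}.
power-bound : ∀ (f : ℕ → Series) → (∀ m → f m 0 ≡ 0ℚ) → ∀ N → CoefficientBounds f N →
              ∀ k j → j ℕ.≤ k ℕ.+ N → BigO (j ∸ suc k) (λ m → powS (f m) (suc k) j)
power-bound f f0≡0 N bounds zero zero    _  = BigO-zero (λ m → trans (⊛-identityʳ (f m) 0) (f0≡0 m))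
power-bound f f0≡0 N bounds zero (suc j) j≤ =
  BigO-cong (λ m → sym (⊛-identityʳ (f m) (suc j))) (bounds (suc j) (s≤s z≤n) j≤)
power-bound f f0≡0 N bounds (suc k) j j≤ = BigO-sum j (λ i m → f m i * powS (f m) (suc k) (j ∸ i)) term
  where
  term : ∀ i → i ℕ.≤ j → BigO (j ∸ suc (suc k)) (λ m → f m i * powS (f m) (suc k) (j ∸ i))
  term zero    _ = BigO-zero (λ m → trans (cong (_* powS (f m) (suc k) j) (f0≡0 m)) (*-zeroˡ (powS (f m) (suc k) j)))
  term (suc i) i<j with suc k ℕ.≤? j ∸ suc i
  ... | no short = BigO-zero (λ m → trans
    (cong (f m (suc i) *_) (powS-vanish (f m) (f0≡0 m) (suc k) (j ∸ suc i) (ℕP.≰⇒> short))) (*-zeroʳ (f m (suc i))))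
  ... | yes long = BigO-≡ (degree-sum i j k i<j long) (BigO-*
    (bounds (suc i) (s≤s z≤n) (factor-index i<j long j≤))
    (power-bound f f0≡0 N bounds k (j ∸ suc i) (cofactor-index {i} {j} {k} {N} j≤)))

binom-excess : ℕ → ℕ → ℚ
binom-excess p m = ι (suc m ℕ.^ (2 ℕ.+ p)) - ι (m ℕ.^ (2 ℕ.+ p)) - ι ((2 ℕ.+ p) ℕ.* m ℕ.^ suc p)

binom-excess-0 : ∀ m → binom-excess 0 m ≡ 1ℚ
binom-excess-0 m = begin-equality
  ι (suc m ℕ.^ 2) - ι (m ℕ.^ 2) - ι (2 ℕ.* m ℕ.^ 1)
    ≡⟨ cong (λ z → z - ι (m ℕ.^ 2) - ι (2 ℕ.* m ℕ.^ 1))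
         (trans (cong ι (square m)) (trans (ι-+ _ 1) (cong (_+ ι 1) (ι-+ _ _)))) ⟩
  ι (m ℕ.^ 2) + ι (2 ℕ.* m ℕ.^ 1) + ι 1 - ι (m ℕ.^ 2) - ι (2 ℕ.* m ℕ.^ 1)
    ≡⟨ solve 3 (λ a b c → a :+ b :+ c :- a :- b := c) refl (ι (m ℕ.^ 2)) (ι (2 ℕ.* m ℕ.^ 1)) (ι 1) ⟩
  ι 1 ≡⟨ ι1 ⟩
  1ℚ  ∎
  where
  square : ∀ m → suc m ℕ.* (suc m ℕ.* 1) ≡ m ℕ.* (m ℕ.* 1) ℕ.+ 2 ℕ.* (m ℕ.* 1) ℕ.+ 1
  square = solve-∀

-- Recurrence in p for the binomial excess X_p:  X_{p+1} = (m+1)·X_p + (p+2)·m^{p+1},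
-- a consequence of a^{d+1} - b^{d+1} = a(a^d - b^d) + b^d.
binom-excess-step : ∀ p m → binom-excess (suc p) m ≡ binom-excess p m * ι (suc m) + ι (2 ℕ.+ p) * ι (m ℕ.^ suc p)
binom-excess-step p m = begin-equality
  binom-excess (suc p) m
    ≡⟨ cong₂ _-_ (cong₂ _-_ (trans (ι-* (suc m) _) (cong (_* S) (ι-suc m))) (trans (ι-* m _) (cong (x *_) (ι-* m _))))
                 (trans (ι-* (3 ℕ.+ p) _) (cong₂ _*_ (ι-suc (2 ℕ.+ p)) (ι-* m _))) ⟩
  (1ℚ + x) * S - x * (x * u) - (1ℚ + c) * (x * u)
    ≡⟨ solve 4 (λ S x u c → (con 1ℚ :+ x) :* S :- x :* (x :* u) :- (con 1ℚ :+ c) :* (x :* u)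
                        := (S :- x :* u :- c :* u) :* (con 1ℚ :+ x) :+ c :* u) refl S x u c ⟩
  (S - x * u - c * u) * (1ℚ + x) + c * u
    ≡⟨ cong₂ (λ a b → (S - a - b) * (1ℚ + x) + c * u) (sym (ι-* m _)) (sym (ι-* (2 ℕ.+ p) _)) ⟩
  binom-excess p m * (1ℚ + x) + c * u
    ≡⟨ cong (λ z → binom-excess p m * z + c * u) (sym (ι-suc m)) ⟩
  binom-excess p m * ι (suc m) + c * u ∎
  where
  S = ι (suc m ℕ.^ (2 ℕ.+ p))
  x = ι m
  u = ι (m ℕ.^ suc p)
  c = ι (2 ℕ.+ p)

binom-excess-bound : ∀ p → BigO p (binom-excess p)
binom-excess-bound zero    = BigO-cong (λ m → sym (binom-excess-0 m)) (BigO-const 1ℚ)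
binom-excess-bound (suc p) = BigO-cong (λ m → sym (binom-excess-step p m))
  (BigO-+ (BigO-·suc (binom-excess-bound p)) (BigO-* {0} (BigO-const (ι (2 ℕ.+ p))) (BigO-pow (suc p))))

pow-convolution : ∀ q m → sumTo q (λ j → ι (m ℕ.^ j) * ι (m ℕ.^ (q ∸ j))) ≡ ι (suc q ℕ.* m ℕ.^ q)
pow-convolution q m = begin-equality
  sumTo q (λ j → ι (m ℕ.^ j) * ι (m ℕ.^ (q ∸ j)))  ≡⟨ sumTo-cong q same-power ⟩
  sumTo q (λ _ → ι (m ℕ.^ q))                      ≡⟨ sumTo-const q _ ⟩
  ι (suc q) * ι (m ℕ.^ q)                          ≡⟨ sym (ι-* _ _) ⟩
  ι (suc q ℕ.* m ℕ.^ q)                            ∎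
  where
  same-power : ∀ j → j ℕ.≤ q → ι (m ℕ.^ j) * ι (m ℕ.^ (q ∸ j)) ≡ ι (m ℕ.^ q)
  same-power j j≤q = trans (sym (ι-* _ _))
    (cong ι (trans (sym (ℕP.^-distribˡ-+-* m j (q ∸ j))) (cong (m ℕ.^_) (ℕP.m+[n∸m]≡n j≤q))))

-- 2^{p+1} [x^{p+3}] F_m² = Σ_{j+k=p+1} s_j(m) s_k(m): only the inner terms of
-- the square survive, and on them F_m agrees with E_m.
scaled-product : ∀ p m → ι (2 ℕ.^ suc p) * Q m (3 ℕ.+ p) ≡ sumTo (suc p) (λ j → scaled j m * scaled (suc p ∸ j) m)
scaled-product p m = begin-equality
  c * Q m (3 ℕ.+ p)                                               ≡⟨ cong (c *_) (⊛-inner (F m) (F m) (F-0 m) (F-0 m) (suc p)) ⟩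
  c * sumTo (suc p) (λ j → E m (suc j) * E m (suc (suc p ∸ j)))   ≡⟨ sym (sumTo-*ˡ (suc p) c _) ⟩
  sumTo (suc p) (λ j → c * (E m (suc j) * E m (suc (suc p ∸ j)))) ≡⟨ sumTo-cong (suc p) distribute ⟩
  sumTo (suc p) (λ j → scaled j m * scaled (suc p ∸ j) m)         ∎
  where
  c = ι (2 ℕ.^ suc p)
  distribute : ∀ j → j ℕ.≤ suc p → c * (E m (suc j) * E m (suc (suc p ∸ j))) ≡ scaled j m * scaled (suc p ∸ j) m
  distribute j j≤ = begin-equality
    c * (a * b)                                   ≡⟨ cong (_* (a * b)) (sym powers-of-two) ⟩
    ι (2 ℕ.^ j) * ι (2 ℕ.^ (suc p ∸ j)) * (a * b) ≡⟨ solve 4 (λ x y a b → x :* y :* (a :* b) := a :* x :* (b :* y)) refl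
                                                        (ι (2 ℕ.^ j)) (ι (2 ℕ.^ (suc p ∸ j))) a b ⟩
    scaled j m * scaled (suc p ∸ j) m             ∎
    where
    a = E m (suc j)
    b = E m (suc (suc p ∸ j))
    powers-of-two : ι (2 ℕ.^ j) * ι (2 ℕ.^ (suc p ∸ j)) ≡ c
    powers-of-two = trans (sym (ι-* _ _))
      (cong ι (trans (sym (ℕP.^-distribˡ-+-* 2 j _)) (cong (2 ℕ.^_) (ℕP.m+[n∸m]≡n j≤))))

-- s_j s_k - m^j m^k = err_j s_k + m^j err_k = O(m^{j+k-1}).
product-error : ∀ j k → ErrorBound j → ErrorBound k →
  BigO (j ℕ.+ k) (λ m → (scaled j m * scaled k m - ι (m ℕ.^ j) * ι (m ℕ.^ k)) * ι (suc m))
product-error j k ej ek = BigO-cong expand (BigO-+ (BigO-* ej (scaled-bound k ek)) (BigO-* (BigO-pow j) ek))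
  where
  expand : ∀ m → (err j m * ι (suc m)) * scaled k m + ι (m ℕ.^ j) * (err k m * ι (suc m))
               ≡ (scaled j m * scaled k m - ι (m ℕ.^ j) * ι (m ℕ.^ k)) * ι (suc m)
  expand m = solve 5 (λ a b u v s → ((a :- u) :* s) :* b :+ u :* ((b :- v) :* s) := (a :* b :- u :* v) :* s) refl
    (scaled j m) (scaled k m) (ι (m ℕ.^ j)) (ι (m ℕ.^ k)) (ι (suc m))

quad-excess : ℕ → ℕ → ℚ
quad-excess p m = ι (2 ℕ.^ suc p) * Q m (3 ℕ.+ p) - ι ((2 ℕ.+ p) ℕ.* m ℕ.^ suc p)

quad-excess-sum : ∀ p m → sumTo (suc p) (λ j → (scaled j m * scaled (suc p ∸ j) m - ι (m ℕ.^ j) * ι (m ℕ.^ (suc p ∸ j))) * ι (suc m))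
                          ≡ quad-excess p m * ι (suc m)
quad-excess-sum p m = begin-equality
  sumTo (suc p) (λ j → (a j - b j) * ι (suc m))  ≡⟨ sumTo-*ʳ (suc p) (ι (suc m)) (λ j → a j - b j) ⟩
  sumTo (suc p) (λ j → a j - b j) * ι (suc m)    ≡⟨ cong (_* ι (suc m)) (sumTo-sub (suc p) a b) ⟩
  (sumTo (suc p) a - sumTo (suc p) b) * ι (suc m) ≡⟨ cong₂ (λ u v → (u - v) * ι (suc m)) (sym (scaled-product p m)) (pow-convolution (suc p) m) ⟩
  quad-excess p m * ι (suc m)                    ∎
  where
  a b : ℕ → ℚ
  a j = scaled j m * scaled (suc p ∸ j) m
  b j = ι (m ℕ.^ j) * ι (m ℕ.^ (suc p ∸ j))

err-increment : ∀ p m → err (2 ℕ.+ p) (suc m) ≡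
  err (2 ℕ.+ p) m + (quad-excess p m + ι (2 ℕ.^ (2 ℕ.+ p)) * higher m p - binom-excess p m)
err-increment p m = begin-equality
  E (suc m) I * A - S                             ≡⟨ cong (λ z → z * A - S) (E-step m p) ⟩
  (e + (h * q + t)) * A - S                       ≡⟨ solve 6 (λ e h q t a s → (e :+ (h :* q :+ t)) :* a :- s
                                                                := e :* a :+ (h :* a) :* q :+ a :* t :- s) refl e h q t A S ⟩
  e * A + (h * A) * q + A * t - S                 ≡⟨ cong (λ z → e * A + z * q + A * t - S) half-power ⟩
  e * A + c * q + A * t - S                       ≡⟨ solve 8 (λ e c q t a s u v → e :* a :+ c :* q :+ a :* t :- s
                                                                := (e :* a :- u) :+ ((c :* q :- v) :+ a :* t :- (s :- u :- v)))
                                                              refl e c q t A S U V ⟩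
  (e * A - U) + ((c * q - V) + A * t - (S - U - V)) ∎
  where
  I = 3 ℕ.+ p
  A = ι (2 ℕ.^ (2 ℕ.+ p))
  c = ι (2 ℕ.^ suc p)
  S = ι (suc m ℕ.^ (2 ℕ.+ p))
  U = ι (m ℕ.^ (2 ℕ.+ p))
  V = ι ((2 ℕ.+ p) ℕ.* m ℕ.^ suc p)
  e = E m I
  h = invFact 2
  q = Q m I
  t = higher m p
  half-power : h * A ≡ c
  half-power = trans (cong (h *_) (ι-* 2 (2 ℕ.^ suc p)))
    (trans (sym (*-assoc h (ι 2) c)) (trans (cong (_* c) half-of-two) (*-identityˡ c)))

module InductionStep (p : ℕ) (IH : ∀ j → j ℕ.≤ suc p → ErrorBound j) where

  F-coefficients : CoefficientBounds F (2 ℕ.+ p)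
  F-coefficients (suc j) _ j<n = E-bound j (IH j (ℕP.≤-pred j<n))

  -- [x^{p+3}] F_m^{k+3} = O(m^{p-k}).
  higher-bound : BigO p (λ m → higher m p)
  higher-bound = BigO-sum p (λ k m → invFact (3 ℕ.+ k) * powS (F m) (3 ℕ.+ k) (3 ℕ.+ p)) λ k _ →
    BigO-* {0} (BigO-const (invFact (3 ℕ.+ k))) (BigO-weaken (ℕP.m∸n≤m p k)
      (power-bound F F-0 (2 ℕ.+ p) F-coefficients (2 ℕ.+ k) (3 ℕ.+ p)
        (s≤s (s≤s (ℕP.≤-trans (ℕP.n≤1+n (suc p)) (ℕP.m≤n+m (2 ℕ.+ p) k))))))

  quad-excess-bound : BigO p (quad-excess p)
  quad-excess-bound = BigO-/suc (BigO-cong (quad-excess-sum p) (BigO-sum (suc p) _ λ j j≤ →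
    BigO-≡ (ℕP.m+[n∸m]≡n j≤) (product-error j (suc p ∸ j) (IH j j≤) (IH (suc p ∸ j) (ℕP.m∸n≤m (suc p) j)))))

  result : ErrorBound (2 ℕ.+ p)
  result = BigO-·suc (BigO-telescope (err (2 ℕ.+ p)) _ (err-increment p)
    (BigO-- (BigO-+ quad-excess-bound (BigO-* {0} (BigO-const (ι (2 ℕ.^ (2 ℕ.+ p)))) higher-bound)) (binom-excess-bound p)))

error-bound : ∀ n → ErrorBound n
error-bound = <-rec ErrorBound step
  where
  step : ∀ n → (∀ {j} → j ℕ.< n → ErrorBound j) → ErrorBound n
  step zero          _  = error-bound-0
  step (suc zero)    _  = error-bound-1
  step (suc (suc p)) ih = InductionStep.result p (λ j j≤ → ih (s≤s j≤))

ratio-error : ∀ n m → (ratio (suc n) (suc m) - 1ℚ) * ι (suc m ℕ.^ n) ≡ err n (suc m)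
ratio-error n m = begin-equality
  ((+ N / 1) * e * r - 1ℚ) * ι P   ≡⟨ cong (λ z → (z * e * r - 1ℚ) * ι P) (fraction-whole N) ⟩
  (ι N * e * r - 1ℚ) * ι P         ≡⟨ solve 4 (λ a e r p → (a :* e :* r :- con 1ℚ) :* p := e :* (r :* (a :* p)) :- p) refl (ι N) e r (ι P) ⟩
  e * (r * (ι N * ι P)) - ι P      ≡⟨ cong (λ z → e * (r * z) - ι P) (sym (ι-* N P)) ⟩
  e * (r * ι (N ℕ.* P)) - ι P      ≡⟨ cong (λ z → e * z - ι P) (fraction-cancel (2 ℕ.^ n) (N ℕ.* P) {{N*P≢0}}) ⟩
  e * ι (2 ℕ.^ n) - ι P            ∎
  where
  N = suc n ℕ.!
  P = suc m ℕ.^ n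
  e = E (suc m) (suc n)
  N*P≢0 : ℕ.NonZero (N ℕ.* P)
  N*P≢0 = ℕP.m*n≢0 N P {{suc n ℕP.!≢0}} {{ℕP.m^n≢0 (suc m) n}}
  r : ℚ
  r = (+ (2 ℕ.^ n) / (N ℕ.* P)) {{N*P≢0}}

ratio-bound : ∀ n → ErrorBound n → Σ ℕ λ K → ∀ m → ∣ ratio (suc n) (suc m) - 1ℚ ∣ * ι (suc m) ≤ ι K
ratio-bound n eb = BigO.const shifted , bound
  where
  shifted : BigO n (λ m → err n (suc m) * ι (suc (suc m)))
  shifted = BigO-shift eb
  bound : ∀ m → ∣ ratio (suc n) (suc m) - 1ℚ ∣ * ι (suc m) ≤ ι (BigO.const shifted)
  bound m = *-cancelʳ-≤-pos (ι P) {{ι-pos P {{ℕP.m^n≢0 (suc m) n}}}} (begin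
    u * ι (suc m) * ι P          ≡⟨ solve 3 (λ u s p → u :* s :* p := u :* p :* s) refl u (ι (suc m)) (ι P) ⟩
    u * ι P * ι (suc m)          ≡⟨ cong (_* ι (suc m)) (trans (sym (∣*ι∣ (ratio (suc n) (suc m) - 1ℚ) P)) (cong ∣_∣ (ratio-error n m))) ⟩
    ∣ e ∣ * ι (suc m)            ≤⟨ *-monoˡ-≤-nonNeg ∣ e ∣ {{∣-∣-nonNeg e}} (ι-mono (ℕP.n≤1+n (suc m))) ⟩
    ∣ e ∣ * ι (suc (suc m))      ≡⟨ sym (∣*ι∣ e (suc (suc m))) ⟩
    ∣ e * ι (suc (suc m)) ∣      ≤⟨ BigO.bound shifted m ⟩
    ι (BigO.const shifted ℕ.* P) ≡⟨ ι-* _ P ⟩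
    ι (BigO.const shifted) * ι P ∎)
    where
    P = suc m ℕ.^ n
    u = ∣ ratio (suc n) (suc m) - 1ℚ ∣
    e = err n (suc m)

converges-from-bound : ∀ (s : ℕ → ℚ) L K → (∀ m → ∣ s (suc m) - L ∣ * ι (suc m) ≤ ι K) → ConvergesTo s L
converges-from-bound s L K bound ε 0<ε with positive-as-fraction ε 0<ε
... | a , b , ε[b+1]≡a+1 , ε≥0 = M , close
  where
  M = suc K ℕ.* suc b
  close : ∀ m → M ℕ.≤ m → ∣ s m - L ∣ < ε
  close (suc m) M≤m = *-cancelʳ-<-nonNeg (ι (suc m)) (≤-<-trans (bound m) (begin-strict
    ι K                          <⟨ ι-< (ℕP.n<1+n K) ⟩
    ι (suc K)                    ≤⟨ ι-mono (ℕP.m≤m*n (suc K) (suc a)) ⟩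
    ι (suc K ℕ.* suc a)          ≡⟨ ι-* (suc K) (suc a) ⟩
    ι (suc K) * ι (suc a)        ≡⟨ cong (ι (suc K) *_) (sym ε[b+1]≡a+1) ⟩
    ι (suc K) * (ε * ι (suc b))  ≡⟨ solve 3 (λ k e b → k :* (e :* b) := e :* (k :* b)) refl (ι (suc K)) ε (ι (suc b)) ⟩
    ε * (ι (suc K) * ι (suc b))  ≡⟨ cong (ε *_) (sym (ι-* (suc K) (suc b))) ⟩
    ε * ι M                      ≤⟨ *-monoˡ-≤-nonNeg ε {{ε≥0}} (ι-mono M≤m) ⟩
    ε * ι (suc m)                ∎))

theorem1 : (n : ℕ) → 1 ℕ.≤ n → ConvergesTo (ratio n) 1ℚ
theorem1 (suc n) _ = converges-from-bound (ratio (suc n)) 1ℚ (proj₁ relative-error) (proj₂ relative-error)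
  where
  relative-error : Σ ℕ λ K → ∀ m → ∣ ratio (suc n) (suc m) - 1ℚ ∣ * ι (suc m) ≤ ι K
  relative-error = ratio-bound n (error-bound n)
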